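{- For all terms $f$ and $u$, the term $Z\{f\}\,u$ reduces in finitely many steps to $f\;{\bf tagged}\{Z\{f\}, K u\}\;u$.
   Context: Terms are given by the grammar $p ::= S \mid K \mid p\,q \mid y$, where $S$ and $K$ are constants, $y$ ranges over term variables, and application is left-associative. One-step reduction is the compatible closure (reduction may occur in any subterm) of the rules $S\,M\,N\,P \longrightarrow M\,P\,(N\,P)$ and $K\,M\,N \longrightarrow M$; "reduces in finitely many steps" means its reflexive–transitive closure. Let $I = SKK$ and let ${\bf fv}(t)$ denote the set of variables occurring in $t$. Star abstraction $\lambda x.t$ is defined by recursion on $t$: if $t$ is a variable $y$, then $\lambda x.t = I$ if $y=x$ and $K\,y$ otherwise; $\lambda x.S = KS$; $\lambda x.K = KK$; for $t = t_1 t_2$, $\lambda x.t = S(\lambda x.t_1)(\lambda x.t_2)$ if $x\in{\bf fv}(t_1t_2)$ and $K(t_1t_2)$ otherwise; nested abstractions $\lambda w.\lambda f.\lambda x.t$ are computed from the inside out. Define ${\bf tagged}\{f,t\} = S(S(KK)f)\big(S(S(KK)(KK))(Kt)\big)$, ${\bf wait2}\{M,N,P\} = S(S(S(KM)(KN))(KP))I$, and ${\bf Z\_tag} = K$. Let $w, f, x$ be distinct variables and define the closed term $\omega = \lambda w.\lambda f.\lambda x.\; f\;{\bf tagged}\{{\bf tagged}\{{\bf wait2}\{w,w,f\}, {\bf Z\_tag}\}, K x\}\;x$. For a term $f$, define $Z\{f\} = {\bf tagged}\{{\bf wait2}\{\omega,\omega,f\}, {\bf Z\_tag}\}$. -}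

module Defs where

open import Data.Nat using (ℕ; _≟_)
open import Data.Bool using (Bool; true; false; _∨_; if_then_else_)
open import Relation.Nullary.Decidable using (⌊_⌋)
open import Relation.Binary.Construct.Closure.ReflexiveTransitive using (Star)

infixl 9 _·_
data Term : Set where
  S K : Term
  _·_ : Term → Term → Term
  var : ℕ → Term

infix 4 _⟶_
data _⟶_ : Term → Term → Set where
  redS : ∀ M N P → S · M · N · P ⟶ M · P · (N · P)
  redK : ∀ M N → K · M · N ⟶ M
  appL : ∀ {p p′} q → p ⟶ p′ → p · q ⟶ p′ · q
  appR : ∀ p {q q′} → q ⟶ q′ → p · q ⟶ p · q′

infix 4 _⟶*_
_⟶*_ : Term → Term → Set
_⟶*_ = Star _⟶_

I : Term
I = S · K · K

occurs : ℕ → Term → Bool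
occurs x S = false
occurs x K = false
occurs x (t · u) = occurs x t ∨ occurs x u
occurs x (var y) = ⌊ x ≟ y ⌋

abs : ℕ → Term → Term
abs x (var y) = if ⌊ x ≟ y ⌋ then I else K · var y
abs x S = K · S
abs x K = K · K
abs x (t₁ · t₂) =
  if occurs x (t₁ · t₂) then S · abs x t₁ · abs x t₂ else K · (t₁ · t₂)

tagged : Term → Term → Term
tagged f t = S · (S · (K · K) · f) · (S · (S · (K · K) · (K · K)) · (K · t))

wait2 : Term → Term → Term → Term
wait2 M N P = S · (S · (S · (K · M) · (K · N)) · (K · P)) · I

Z-tag : Term
Z-tag = K

w′ f′ x′ : ℕ
w′ = 0
f′ = 1
x′ = 2

ω : Term
ω = abs w′ (abs f′ (abs x′
      (var f′ · tagged (tagged (wait2 (var w′) (var w′) (var f′)) Z-tag) (K · var x′) · var x′)))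

Z : Term → Term
Z f = tagged (wait2 ω ω f) Z-tag

{-# OPTIONS --safe #-}
-- Star abstraction satisfies β-reduction up to ⟶*, so applying ω · ω · f to u
-- instantiates the body of ω; and Z f · u first discards the tag Z-tag and then
-- lets wait2 release the delayed application ω · ω · f to u.
module Submission where

open import Defs
open import Data.Nat using (ℕ; _≟_)
open import Data.Bool using (true; false; if_then_else_)
open import Data.Bool.Properties using (∨-conicalˡ; ∨-conicalʳ)
open import Relation.Nullary using (yes; no)
open import Relation.Nullary.Decidable using (⌊_⌋)
open import Relation.Binary.PropositionalEquality using (_≡_; refl; sym; cong; cong₂; subst)
open import Relation.Binary.Construct.Closure.ReflexiveTransitive using (ε; _◅_; _◅◅_; gmap)
open import Relation.Binary.Construct.Closure.ReflexiveTransitive.Properties using (module StarReasoning)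

Env : Set
Env = ℕ → Term

infixl 10 _[_] _[_≔_]

_[_] : Term → Env → Term
S [ σ ] = S
K [ σ ] = K
(t · u) [ σ ] = t [ σ ] · u [ σ ]
var y [ σ ] = σ y

_[_≔_] : Env → ℕ → Term → Env
(σ [ x ≔ U ]) y = if ⌊ x ≟ y ⌋ then U else σ y

appL* : ∀ {p p′} q → p ⟶* p′ → p · q ⟶* p′ · q
appL* q = gmap (_· q) (appL q)

appR* : ∀ p {q q′} → q ⟶* q′ → p · q ⟶* p · q′
appR* p = gmap (p ·_) (appR p)

subst-fresh : ∀ σ x U t → occurs x t ≡ false → t [ σ ] ≡ t [ σ [ x ≔ U ] ]
subst-fresh σ x U S _ = refl
subst-fresh σ x U K _ = refl
subst-fresh σ x U (t · u) x∉tu = cong₂ _·_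
  (subst-fresh σ x U t (∨-conicalˡ (occurs x t) (occurs x u) x∉tu))
  (subst-fresh σ x U u (∨-conicalʳ (occurs x t) (occurs x u) x∉tu))
subst-fresh σ x U (var y) x∉y = cong (λ b → if b then U else σ y) (sym x∉y)

I-β : ∀ U → I · U ⟶* U
I-β U = redS K K U ◅ redK U (K · U) ◅ ε

abs-β : ∀ σ x t U → abs x t [ σ ] · U ⟶* t [ σ [ x ≔ U ] ]
abs-β σ x S U = redK S U ◅ ε
abs-β σ x K U = redK K U ◅ ε
abs-β σ x (var y) U with x ≟ y
... | yes _ = I-β U
... | no _ = redK (σ y) U ◅ ε
abs-β σ x (t₁ · t₂) U with occurs x (t₁ · t₂) in occurs≡
... | true = redS _ _ U ◅ appL* _ (abs-β σ x t₁ U) ◅◅ appR* _ (abs-β σ x t₂ U)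
... | false = redK _ U ◅ subst ((t₁ · t₂) [ σ ] ⟶*_) (subst-fresh σ x U (t₁ · t₂) occurs≡) ε

tagged-β : ∀ f t u → tagged f t · u ⟶* f · u
tagged-β f t u =
  redS _ _ u ◅ appL _ (redS _ _ u) ◅ appL _ (appL _ (redK K u)) ◅ redK (f · u) _ ◅ ε

wait2-β : ∀ M N P u → wait2 M N P · u ⟶* M · N · P · u
wait2-β M N P u =
  redS _ _ u ◅ appL _ (redS _ _ u) ◅ appL _ (appL _ (redS _ _ u)) ◅
  appL _ (appL _ (appL _ (redK M u))) ◅ appL _ (appL _ (appR _ (redK N u))) ◅
  appL _ (appR _ (redK P u)) ◅ appR* _ (I-β u)

-- The three environment updates compute away, the variable names being numerals.
ω-β : ∀ f u → ω · ω · f · u ⟶* f · tagged (Z f) (K · u) · u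
ω-β f u =
  appL* u (appL* f (abs-β var w′ (abs f′ (abs x′ body)) ω)) ◅◅
  appL* u (abs-β (var [ w′ ≔ ω ]) f′ (abs x′ body) f) ◅◅
  abs-β (var [ w′ ≔ ω ] [ f′ ≔ f ]) x′ body u
  where
  body : Term
  body = var f′ · tagged (tagged (wait2 (var w′) (var w′) (var f′)) Z-tag) (K · var x′) · var x′

mainTheorem3 : ∀ (f u : Term) → Z f · u ⟶* f · tagged (Z f) (K · u) · u
mainTheorem3 f u = begin
  Z f · u                      ⟶*⟨ tagged-β (wait2 ω ω f) Z-tag u ⟩
  wait2 ω ω f · u              ⟶*⟨ wait2-β ω ω f u ⟩
  ω · ω · f · u                ⟶*⟨ ω-β f u ⟩
  f · tagged (Z f) (K · u) · u ∎
  where open StarReasoning _⟶_
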